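{- Let $S_0=(s_{i,j})_{1\le i,j\le 3}$ be a $3\times 3$ array whose entries are $1,\ldots,9$, each used exactly once, let $X:=\{s_{1,2},s_{1,3},s_{2,1},s_{2,3},s_{3,1},s_{3,2}\}$, and let $a\in\mathbb{Z}\setminus\{0\}$. Let $S_a$ be the array obtained from $S_0$ by keeping the diagonal entries and replacing $s_{1,2},s_{1,3},s_{2,1},s_{2,3},s_{3,1},s_{3,2}$ by $s_{1,2}+a,\ s_{1,3}-a,\ s_{2,1}-a,\ s_{2,3}+a,\ s_{3,1}+a,\ s_{3,2}-a$ respectively; say that $S_a$ exists if its nine entries are again exactly $1,\ldots,9$, each used once, equivalently \[ \{s_{1,2}+a,\ s_{1,3}-a,\ s_{2,1}-a,\ s_{2,3}+a,\ s_{3,1}+a,\ s_{3,2}-a\}=X. \] (a) If the triplet $\mathcal{T}_a$ associated to $S_0$ and $a$ does not exist, then $S_a$ does not exist. (b) If the triplet $\mathcal{T}_a$ associated to $S_0$ and $a$ exists, then $S_a$ exists if and only if $\mathcal{T}_a=\{s_{1,2},s_{2,3},s_{3,1}\}$.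
   Context: The triplet $\mathcal{T}_a$ associated to $a$ and $S_0$ exists if there are $y_1,y_2,y_3\in X$ with $y_1<y_2<y_3$ such that $\{y_1,y_1+a,y_2,y_2+a,y_3,y_3+a\}=X$; such a set $\{y_1,y_2,y_3\}$ is then unique and is denoted $\mathcal{T}_a$. Note that whenever $S_a$ exists, it has the same diagonal, row sums and column sums as $S_0$. -}

module Defs where

open import Data.Integer using (ℤ; +_; _+_; _-_; _≤_; _<_)
open import Data.Fin using (Fin; zero; suc)
open import Data.List using (List; []; _∷_)
open import Data.List.Membership.Propositional using (_∈_)
open import Data.Product using (_×_; ∃)
open import Function.Bundles using (_⇔_)
open import Function.Definitions using (Injective)
open import Relation.Binary.PropositionalEquality using (_≡_)

-- A 3×3 array, entries indexed by (row, column) ∈ Fin 3 × Fin 3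
-- (index 0,1,2 corresponds to 1,2,3 in the paper).
Array : Set
Array = Fin 3 → Fin 3 → ℤ

i1 i2 i3 : Fin 3
i1 = zero
i2 = suc zero
i3 = suc (suc zero)

_≐_ : List ℤ → List ℤ → Set
xs ≐ ys = ∀ z → (z ∈ xs) ⇔ (z ∈ ys)

-- The entries of S are 1,…,9, each used exactly once:
-- all entries lie in [1,9] and distinct positions carry distinct entries.
IsMagicFilling : Array → Set
IsMagicFilling S =
  (∀ i j → (+ 1 ≤ S i j) × (S i j ≤ + 9)) ×
  (∀ i j k l → S i j ≡ S k l → (i ≡ k) × (j ≡ l))

Xset : Array → List ℤ
Xset S = S i1 i2 ∷ S i1 i3 ∷ S i2 i1 ∷ S i2 i3 ∷ S i3 i1 ∷ S i3 i2 ∷ []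

SaExists : Array → ℤ → Set
SaExists S a =
  (S i1 i2 + a ∷ S i1 i3 - a ∷ S i2 i1 - a ∷ S i2 i3 + a ∷ S i3 i1 + a ∷ S i3 i2 - a ∷ [])
  ≐ Xset S

IsTriplet : Array → ℤ → ℤ → ℤ → ℤ → Set
IsTriplet S a y1 y2 y3 =
  (y1 ∈ Xset S) × (y2 ∈ Xset S) × (y3 ∈ Xset S) ×
  (y1 < y2) × (y2 < y3) ×
  ((y1 ∷ y1 + a ∷ y2 ∷ y2 + a ∷ y3 ∷ y3 + a ∷ []) ≐ Xset S)

TripletExists : Array → ℤ → Set
TripletExists S a = ∃ λ y1 → ∃ λ y2 → ∃ λ y3 → IsTriplet S a y1 y2 y3

-- Split X into A = {s₁₂, s₂₃, s₃₁}, the entries that S_a raises by a, and B, the entries it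
-- lowers by a.  Call T a halving of X if X is the disjoint union of T and T + a.  In the
-- bounded set X a halving is unique: if T and P are halvings with z ∈ T ∖ P, then
-- z − a ∈ P, and this configuration reproduces itself at z − 2a, z − 4a, … forever.
-- A triplet is a halving, and S_a exists exactly when A is one: when S_a exists the six
-- values A + a, B − a are distinct (they cover the six elements of X), so an element of A
-- whose shift stayed in A would start an ascending chain inside A, forcing A + a = B.
-- Part (a) follows by listing A increasingly, part (b) by uniqueness of halvings.
module Submission where

open import Defs
open import Data.Integer using (ℤ; +_; -[1+_]; +[1+_]; _+_; _-_; -_; _≤_; _<_; +≤+; +<+)
import Data.Integer.Properties as ℤ
open import Data.Integer.Tactic.RingSolver using (solve-∀)
open import Data.Nat as ℕ using (ℕ; zero; suc)
import Data.Nat.Properties as ℕ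
open import Data.Fin using (Fin; zero; suc; punchOut)
import Data.Fin.Properties as Fin
open import Data.List using (List; []; _∷_; map; length; lookup; tabulate)
open import Data.List.Properties using (tabulate-lookup)
open import Data.List.Membership.Propositional using (_∈_)
open import Data.List.Membership.Propositional.Properties
  using (∈-lookup; ∈-map⁺; ∈-map⁻; ∈-tabulate⁻; ∈-AllPairs₂)
open import Data.List.Relation.Unary.Any using (here; there; index)
open import Data.List.Relation.Unary.Any.Properties using (lookup-index)
open import Data.List.Relation.Unary.All using (_∷_; [])
import Data.List.Relation.Unary.All as All
open import Data.List.Relation.Unary.AllPairs using (_∷_; [])
import Data.List.Relation.Unary.AllPairs.Properties as AllPairs
open import Data.List.Relation.Unary.Linked using ([-]; _∷_)
open import Data.List.Relation.Unary.Unique.Propositional using (Unique)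
open import Data.List.Relation.Unary.Unique.Propositional.Properties using (tabulate⁺)
open import Data.List.Relation.Binary.Subset.Propositional using (_⊆_)
open import Data.List.Relation.Binary.Permutation.Propositional using (_↭_; ↭-sym)
open import Data.List.Relation.Binary.Permutation.Propositional.Properties using (∈-resp-↭; ↭-length)
open import Data.List.Sort ℤ.≤-decTotalOrder using (sort; sort-↭; sort-↗)
open import Data.Product using (∃; ∃₂; _×_; _,_; proj₁; proj₂; uncurry)
open import Data.Product.Properties using (×-≡,≡→≡; ≡-dec)
open import Data.Sum using (_⊎_; inj₁; inj₂)
import Data.Sum as Sum
open import Function using (_∘_; _∘′_)
open import Function.Bundles using (_⇔_; mk⇔; Equivalence)
import Function.Properties.Equivalence as ⇔
open import Function.Definitions using (Injective)
open import Relation.Nullary using (¬_; yes; no; contradiction)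
open import Relation.Nullary.Decidable using (toWitness; _→-dec_)
open import Relation.Binary.PropositionalEquality

module _ {ℓ} {A : Set ℓ} where

  -- If L i ≡ L k with i ≢ k, every X j is also hit by an index other than k,
  -- and punching k out turns this into an injection Fin n → Fin m.
  covering-injective : ∀ {m n} {L : Fin m → A} {X : Fin n → A} → m ℕ.≤ n →
    Injective _≡_ _≡_ X → (∀ j → ∃ λ i → L i ≡ X j) → Injective _≡_ _≡_ L
  covering-injective {zero} _ _ _ {()}
  covering-injective {suc m} {n} {L} {X} m<n X-injective cover {i} {k} Li≡Lk with i Fin.≟ k
  ... | yes i≡k = i≡k
  ... | no i≢k = contradiction (Fin.injective⇒≤ hit-injective) (ℕ.<⇒≱ m<n)
    where
    hit-avoiding-k : ∀ j → ∃ λ i′ → k ≢ i′ × L i′ ≡ X j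
    hit-avoiding-k j with cover j
    ... | i′ , Li′≡Xj with k Fin.≟ i′
    ...   | yes refl = i , i≢k ∘ sym , trans Li≡Lk Li′≡Xj
    ...   | no k≢i′  = i′ , k≢i′ , Li′≡Xj

    hit : Fin n → Fin m
    hit j = punchOut (proj₁ (proj₂ (hit-avoiding-k j)))

    hit-injective : Injective _≡_ _≡_ hit
    hit-injective {j} {j′} hitj≡hitj′ with hit-avoiding-k j | hit-avoiding-k j′
    ... | i′ , k≢i′ , Li′≡Xj | i″ , k≢i″ , Li″≡Xj′ = X-injective (begin
      X j   ≡⟨ sym Li′≡Xj ⟩
      L i′  ≡⟨ cong L (Fin.punchOut-injective k≢i′ k≢i″ hitj≡hitj′) ⟩
      L i″  ≡⟨ Li″≡Xj′ ⟩
      X j′  ∎)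
      where open ≡-Reasoning

  lookup-injective : ∀ {xs : List A} → Unique xs → Injective _≡_ _≡_ (lookup xs)
  lookup-injective (_  ∷ _) {zero}  {zero}  _ = refl
  lookup-injective (x∉ ∷ _) {zero}  {suc j} e = contradiction e (All.lookup x∉ (∈-lookup j))
  lookup-injective (x∉ ∷ _) {suc i} {zero}  e = contradiction (sym e) (All.lookup x∉ (∈-lookup i))
  lookup-injective (_  ∷ u) {suc i} {suc j} e = cong suc (lookup-injective u e)

  covering-unique : ∀ {xs ys : List A} → length xs ℕ.≤ length ys → ys ⊆ xs → Unique ys → Unique xs
  covering-unique {xs} {ys} len ys⊆xs ys-unique =
    subst Unique (tabulate-lookup xs) (tabulate⁺ (covering-injective len (lookup-injective ys-unique) cover))
    where
    cover : ∀ j → ∃ λ i → lookup xs i ≡ lookup ys j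
    cover j = index (ys⊆xs (∈-lookup j)) , sym (lookup-index (ys⊆xs (∈-lookup j)))

  unique-map-injective : ∀ {B : Set} {f : A → B} {xs u w} →
    Unique (map f xs) → u ∈ xs → w ∈ xs → f u ≡ f w → u ≡ w
  unique-map-injective unique u∈ w∈ fu≡fw with ∈-AllPairs₂ (AllPairs.map⁻ unique) u∈ w∈
  ... | inj₁ u≡w          = u≡w
  ... | inj₂ (inj₁ fu≢fw) = contradiction fu≡fw fu≢fw
  ... | inj₂ (inj₂ fw≢fu) = contradiction (sym fu≡fw) fw≢fu

i+j-j≡i : ∀ i j → i + j - j ≡ i
i+j-j≡i = solve-∀

i-j+j≡i : ∀ i j → i - j + j ≡ i
i-j+j≡i = solve-∀

Bounded : (ℤ → Set) → Set
Bounded Q = ∃₂ λ lo d → ∀ {z} → Q z → lo ≤ z × z ≤ lo + + d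

Bounded-⊆ : ∀ {P Q : ℤ → Set} → (∀ {z} → P z → Q z) → Bounded Q → Bounded P
Bounded-⊆ P⊆Q (lo , d , bounds) = lo , d , bounds ∘′ P⊆Q

Bounded-neg : ∀ {Q : ℤ → Set} → Bounded Q → Bounded (λ z → Q (- z))
Bounded-neg {Q} (lo , d , bounds) = - (lo + + d) , d , λ {z} Q-z →
  subst (- (lo + + d) ≤_) (ℤ.neg-involutive z) (ℤ.neg-mono-≤ (proj₂ (bounds Q-z))) ,
  subst₂ _≤_ (ℤ.neg-involutive z) (-lo≡-[lo+d]+d lo (+ d)) (ℤ.neg-mono-≤ (proj₁ (bounds Q-z)))
  where
  -lo≡-[lo+d]+d : ∀ lo d → - lo ≡ - (lo + d) + d
  -lo≡-[lo+d]+d = solve-∀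

ascending-orbit : ∀ {Q : ℤ → Set} {c} → + 1 ≤ c → Bounded Q → (∀ {z} → Q z → Q (z + c)) → ∀ {z} → ¬ Q z
ascending-orbit {Q} {c} 1≤c (lo , d , bounds) step {z} Qz = ℤ.<-irrefl refl (begin-strict
  lo + + suc d  ≤⟨ ℤ.+-monoˡ-≤ (+ suc d) (proj₁ (bounds Qz)) ⟩
  z + + suc d   ≤⟨ climb (suc d) Qz ⟩
  lo + + d      <⟨ ℤ.+-monoʳ-< lo (+<+ (ℕ.n<1+n d)) ⟩
  lo + + suc d  ∎)
  where
  open ℤ.≤-Reasoning
  climb : ∀ n {w} → Q w → w + + n ≤ lo + + d
  climb zero    {w} Qw = ℤ.≤-trans (ℤ.≤-reflexive (ℤ.+-identityʳ w)) (proj₂ (bounds Qw))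
  climb (suc n) {w} Qw = begin
    w + (+ 1 + + n)  ≡⟨ ℤ.+-assoc w (+ 1) (+ n) ⟨
    w + + 1 + + n    ≤⟨ ℤ.+-monoˡ-≤ (+ n) (ℤ.+-monoʳ-≤ w 1≤c) ⟩
    w + c + + n      ≤⟨ climb n (step Qw) ⟩
    lo + + d         ∎

bounded-orbit : ∀ {Q : ℤ → Set} {c} → c ≢ + 0 → Bounded Q → (∀ {z} → Q z → Q (z + c)) → ∀ {z} → ¬ Q z
bounded-orbit {c = + zero}   c≢0 _ _ _ = c≢0 refl
bounded-orbit {c = +[1+ _ ]} _ bounded step = ascending-orbit (+≤+ (ℕ.s≤s ℕ.z≤n)) bounded step
bounded-orbit {Q} {c = -[1+ k ]} _ bounded step {z} Qz =
  ascending-orbit (+≤+ (ℕ.s≤s ℕ.z≤n)) (Bounded-neg bounded) step-neg (subst Q (sym (ℤ.neg-involutive z)) Qz)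
  where
  step-neg : ∀ {u} → Q (- u) → Q (- (u + +[1+ k ]))
  step-neg {u} Q-u = subst Q (sym (ℤ.neg-distrib-+ u +[1+ k ])) (step Q-u)

-- A triplet 𝒯_a of the paper is a halving of X with three elements.
record Halving (a : ℤ) (X T : ℤ → Set) : Set where
  field
    inside         : ∀ {z} → T z → X z
    shifted-inside : ∀ {z} → T z → X (z + a)
    covers         : ∀ {z} → X z → T z ⊎ T (z - a)
    separated      : ∀ {z} → T z → ¬ T (z + a)

Halving-resp : ∀ {a X T P} → (∀ z → T z ⇔ P z) → Halving a X T → Halving a X P
Halving-resp {T = T} {P} T⇔P H = record
  { inside         = inside ∘ from
  ; shifted-inside = shifted-inside ∘ from
  ; covers         = Sum.map to to ∘ covers
  ; separated      = λ Pz Pz+a → separated (from Pz) (from Pz+a)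
  }
  where
  open Halving H
  to : ∀ {z} → T z → P z
  to = Equivalence.to (T⇔P _)
  from : ∀ {z} → P z → T z
  from = Equivalence.from (T⇔P _)

-a-a≢0 : ∀ {a} → a ≢ + 0 → - a - a ≢ + 0
-a-a≢0 {+ zero}    a≢0 = contradiction refl a≢0
-a-a≢0 {+[1+ _ ]}  _ ()
-a-a≢0 { -[1+ _ ]} _ ()

module _ {a : ℤ} (a≢0 : a ≢ + 0) {X : ℤ → Set} (X-bounded : Bounded X) where

  halving-⊆ : ∀ {T P} → Halving a X T → Halving a X P → ∀ {z} → T z → P z
  halving-⊆ {T} {P} HT HP {z} Tz with Halving.covers HP (Halving.inside HT Tz)
  ... | inj₁ Pz   = Pz
  ... | inj₂ Pz-a = contradiction (Tz , Pz-a)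
                      (bounded-orbit (-a-a≢0 a≢0) (Bounded-⊆ (HT.inside ∘ proj₁) X-bounded) descend)
    where
    module HT = Halving HT
    module HP = Halving HP
    descend : ∀ {w} → T w × P (w - a) → T (w + (- a - a)) × P (w + (- a - a) - a)
    descend {w} (Tw , Pw-a) with HT.covers (HP.inside Pw-a)
    ... | inj₁ Tw-a = contradiction (subst T (sym (i-j+j≡i w a)) Tw) (HT.separated Tw-a)
    ... | inj₂ Tw-a-a with HP.covers (HT.inside Tw-a-a)
    ...   | inj₁ Pw-a-a   = contradiction (subst P (sym (i-j+j≡i (w - a) a)) Pw-a) (HP.separated Pw-a-a)
    ...   | inj₂ Pw-a-a-a = subst T (ℤ.+-assoc w (- a) (- a)) Tw-a-a ,
                            subst (λ v → P (v - a)) (ℤ.+-assoc w (- a) (- a)) Pw-a-a-a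

  halving-unique : ∀ {T P} → Halving a X T → Halving a X P → ∀ z → T z ⇔ P z
  halving-unique HT HP z = mk⇔ (halving-⊆ HT HP) (halving-⊆ HP HT)

withShifts : ℤ → List ℤ → List ℤ
withShifts a []       = []
withShifts a (y ∷ ys) = y ∷ y + a ∷ withShifts a ys

module _ {a : ℤ} where

  ∈-withShifts⁺ˡ : ∀ {z ys} → z ∈ ys → z ∈ withShifts a ys
  ∈-withShifts⁺ˡ (here refl) = here refl
  ∈-withShifts⁺ˡ (there z∈)  = there (there (∈-withShifts⁺ˡ z∈))

  ∈-withShifts⁺ʳ : ∀ {z ys} → z ∈ ys → z + a ∈ withShifts a ys
  ∈-withShifts⁺ʳ (here refl) = there (here refl)
  ∈-withShifts⁺ʳ (there z∈)  = there (there (∈-withShifts⁺ʳ z∈))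

  ∈-withShifts⁻ : ∀ {z} ys → z ∈ withShifts a ys → z ∈ ys ⊎ z - a ∈ ys
  ∈-withShifts⁻ (y ∷ _)  (here refl)         = inj₁ (here refl)
  ∈-withShifts⁻ (y ∷ _)  (there (here refl)) = inj₂ (here (i+j-j≡i y a))
  ∈-withShifts⁻ (_ ∷ ys) (there (there z∈))  = Sum.map there there (∈-withShifts⁻ ys z∈)

  withShifts-separated : ∀ {z ys} → Unique (withShifts a ys) → z ∈ ys → ¬ (z + a ∈ ys)
  withShifts-separated (y∉ ∷ _)         (here refl) (here y+a≡y) = All.head y∉ (sym y+a≡y)
  withShifts-separated (_ ∷ y+a∉ ∷ _)   (here refl) (there y+a∈) = All.lookup y+a∉ (∈-withShifts⁺ˡ y+a∈) refl
  withShifts-separated (y∉ ∷ _)         (there z∈)  (here z+a≡y) =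
    All.lookup (All.tail y∉) (∈-withShifts⁺ʳ z∈) (sym z+a≡y)
  withShifts-separated (_ ∷ _ ∷ unique) (there z∈)  (there z+a∈) = withShifts-separated unique z∈ z+a∈

  withShifts≐⇒halving : ∀ {xs ys} → Unique (withShifts a ys) → withShifts a ys ≐ xs → Halving a (_∈ xs) (_∈ ys)
  withShifts≐⇒halving {ys = ys} unique ys±≐xs = record
    { inside         = to ∘ ∈-withShifts⁺ˡ
    ; shifted-inside = to ∘ ∈-withShifts⁺ʳ
    ; covers         = ∈-withShifts⁻ ys ∘ Equivalence.from (ys±≐xs _)
    ; separated      = withShifts-separated unique
    }
    where
    to : ∀ {z} → z ∈ withShifts a ys → z ∈ _
    to = Equivalence.to (ys±≐xs _)

  halving⇒withShifts≐ : ∀ {xs ys} → Halving a (_∈ xs) (_∈ ys) → withShifts a ys ≐ xs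
  halving⇒withShifts≐ {ys = ys} H z = mk⇔ to from
    where
    open Halving H
    to : z ∈ withShifts a ys → z ∈ _
    to z∈ with ∈-withShifts⁻ ys z∈
    ... | inj₁ z∈ys   = inside z∈ys
    ... | inj₂ z-a∈ys = subst (_∈ _) (i-j+j≡i z a) (shifted-inside z-a∈ys)
    from : z ∈ _ → z ∈ withShifts a ys
    from z∈xs with covers z∈xs
    ... | inj₁ z∈ys   = ∈-withShifts⁺ˡ z∈ys
    ... | inj₂ z-a∈ys = subst (_∈ withShifts a ys) (i-j+j≡i z a) (∈-withShifts⁺ʳ z-a∈ys)

module _ {c : ℤ} (c≢0 : c ≢ + 0) {X A B : ℤ → Set} (X-bounded : Bounded X)
         (split : ∀ {z} → X z → A z ⊎ B z) (A⊆X : ∀ {z} → A z → X z)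
         (A+c⊆X : ∀ {z} → A z → X (z + c)) (apart : ∀ {p q} → A p → B q → p + c ≢ q - c) where

  -- If p + c were in A, the pair (p, p + c) would climb to (p + c, p + 2c) and on forever:
  -- p + 2c cannot lie in B, as (p + 2c) - c = p + c.
  shift-lands-opposite : ∀ {p} → A p → B (p + c)
  shift-lands-opposite {p} Ap with split (A+c⊆X Ap)
  ... | inj₂ Bp+c = Bp+c
  ... | inj₁ Ap+c = contradiction (Ap , Ap+c) (bounded-orbit c≢0 (Bounded-⊆ (A⊆X ∘ proj₁) X-bounded) climb)
    where
    climb : ∀ {z} → A z × A (z + c) → A (z + c) × A (z + c + c)
    climb {z} (Az , Az+c) with split (A+c⊆X Az+c)
    ... | inj₁ Az+c+c = Az+c , Az+c+c
    ... | inj₂ Bz+c+c = contradiction (sym (i+j-j≡i (z + c) c)) (apart Az Bz+c+c)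

data Sign : Set where
  plus minus : Sign

shiftBy : ℤ → Sign × ℤ → ℤ
shiftBy a (plus  , v) = v + a
shiftBy a (minus , v) = v - a

module _ {a : ℤ} {ps : List (Sign × ℤ)} (values-unique : Unique (map proj₂ ps)) where

  private
    X Plus Minus : ℤ → Set
    X z     = z ∈ map proj₂ ps
    Plus z  = (plus , z) ∈ ps
    Minus z = (minus , z) ∈ ps

  sign-of : ∀ {z} → X z → Plus z ⊎ Minus z
  sign-of z∈ with ∈-map⁻ proj₂ z∈
  ... | (plus  , _) , p∈ , refl = inj₁ p∈
  ... | (minus , _) , m∈ , refl = inj₂ m∈

  signs-disjoint : ∀ {z} → Plus z → ¬ Minus z
  signs-disjoint p∈ m∈ with () ← unique-map-injective values-unique p∈ m∈ refl

  halving⇒shifted≐ : Halving a X Plus → map (shiftBy a) ps ≐ map proj₂ ps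
  halving⇒shifted≐ H z = mk⇔ to from
    where
    open Halving H
    to : z ∈ map (shiftBy a) ps → X z
    to z∈ with ∈-map⁻ (shiftBy a) z∈
    ... | (plus  , _) , p∈ , refl = shifted-inside p∈
    ... | (minus , _) , m∈ , refl with covers (∈-map⁺ proj₂ m∈)
    ...   | inj₁ p∈   = contradiction m∈ (signs-disjoint p∈)
    ...   | inj₂ v-a∈ = inside v-a∈
    from : X z → z ∈ map (shiftBy a) ps
    from z∈ with covers z∈
    ... | inj₂ z-a∈ = subst (_∈ _) (i-j+j≡i z a) (∈-map⁺ (shiftBy a) z-a∈)
    ... | inj₁ z∈+ with sign-of (shifted-inside z∈+)
    ...   | inj₁ z+a∈+ = contradiction z+a∈+ (separated z∈+)
    ...   | inj₂ z+a∈- = subst (_∈ _) (i+j-j≡i z a) (∈-map⁺ (shiftBy a) z+a∈-)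

  module _ (a≢0 : a ≢ + 0) (X-bounded : Bounded X) (shifted≐ : map (shiftBy a) ps ≐ map proj₂ ps)
           (shifted-unique : Unique (map (shiftBy a) ps)) where

    private
      shifted-inside : ∀ {s z} → (s , z) ∈ ps → shiftBy a (s , z) ∈ map proj₂ ps
      shifted-inside = Equivalence.to (shifted≐ _) ∘ ∈-map⁺ (shiftBy a)

      shifts-apart : ∀ {p q} → Plus p → Minus q → p + a ≢ q - a
      shifts-apart p∈ q∈ e with () ← unique-map-injective shifted-unique p∈ q∈ e

      rises : ∀ {p} → Plus p → Minus (p + a)
      rises = shift-lands-opposite a≢0 X-bounded sign-of (∈-map⁺ proj₂) shifted-inside shifts-apart

      falls : ∀ {q} → Minus q → Plus (q - a)
      falls = shift-lands-opposite (a≢0 ∘ ℤ.neg-injective) X-bounded (Sum.swap ∘ sign-of) (∈-map⁺ proj₂)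
                shifted-inside
                (λ {q} {p} q∈ p∈ e → shifts-apart p∈ q∈ (sym (trans e (cong (_+_ p) (ℤ.neg-involutive a)))))

    shifted≐⇒halving : Halving a X Plus
    shifted≐⇒halving = record
      { inside         = ∈-map⁺ proj₂
      ; shifted-inside = shifted-inside
      ; covers         = Sum.map₂ falls ∘ sign-of
      ; separated      = λ z∈ z+a∈ → signs-disjoint z+a∈ (rises z∈)
      }

increasing-listing : ∀ {u v w : ℤ} → Unique (u ∷ v ∷ w ∷ []) →
  ∃ λ y1 → ∃ λ y2 → ∃ λ y3 → y1 < y2 × y2 < y3 × (y1 ∷ y2 ∷ y3 ∷ []) ↭ (u ∷ v ∷ w ∷ [])
increasing-listing {u} {v} {w} uvw-unique
  with sort (u ∷ v ∷ w ∷ []) | sort-↭ (u ∷ v ∷ w ∷ []) | sort-↗ (u ∷ v ∷ w ∷ [])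
... | y1 ∷ y2 ∷ y3 ∷ [] | ys↭uvw | y1≤y2 ∷ y2≤y3 ∷ [-]
  with (y1≢y2 ∷ _ ∷ []) ∷ (y2≢y3 ∷ []) ∷ [] ∷ [] ← covering-unique ℕ.≤-refl (∈-resp-↭ (↭-sym ys↭uvw)) uvw-unique
  = y1 , y2 , y3 , ℤ.≤∧≢⇒< y1≤y2 y1≢y2 , ℤ.≤∧≢⇒< y2≤y3 y2≢y3 , ys↭uvw
... | []                | ys↭uvw | _ = contradiction (↭-length ys↭uvw) λ ()
... | _ ∷ []            | ys↭uvw | _ = contradiction (↭-length ys↭uvw) λ ()
... | _ ∷ _ ∷ []        | ys↭uvw | _ = contradiction (↭-length ys↭uvw) λ ()
... | _ ∷ _ ∷ _ ∷ _ ∷ _ | ys↭uvw | _ = contradiction (↭-length ys↭uvw) λ ()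

-- The entries of X, in the order of Xset, tagged with the sign of the shift they receive in S_a.
offDiagonal : Array → List (Sign × ℤ)
offDiagonal S = (plus , S i1 i2) ∷ (minus , S i1 i3) ∷ (minus , S i2 i1) ∷
                (plus , S i2 i3) ∷ (plus , S i3 i1) ∷ (minus , S i3 i2) ∷ []

plusEntries : Array → List ℤ
plusEntries S = S i1 i2 ∷ S i2 i3 ∷ S i3 i1 ∷ []

plus∈offDiagonal⇔ : ∀ S z → (plus , z) ∈ offDiagonal S ⇔ z ∈ plusEntries S
plus∈offDiagonal⇔ S z = mk⇔ to from
  where
  to : (plus , z) ∈ offDiagonal S → z ∈ plusEntries S
  to (here refl)                                   = here refl
  to (there (here ()))
  to (there (there (here ())))
  to (there (there (there (here refl))))           = there (here refl)
  to (there (there (there (there (here refl)))))   = there (there (here refl))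
  to (there (there (there (there (there (here ()))))))
  from : z ∈ plusEntries S → (plus , z) ∈ offDiagonal S
  from (here refl)                 = here refl
  from (there (here refl))         = there (there (there (here refl)))
  from (there (there (here refl))) = there (there (there (there (here refl))))

offDiagonalPosition : Fin 6 → Fin 3 × Fin 3
offDiagonalPosition zero                                = i1 , i2
offDiagonalPosition (suc zero)                          = i1 , i3
offDiagonalPosition (suc (suc zero))                    = i2 , i1
offDiagonalPosition (suc (suc (suc zero)))              = i2 , i3
offDiagonalPosition (suc (suc (suc (suc zero))))        = i3 , i1
offDiagonalPosition (suc (suc (suc (suc (suc zero)))))  = i3 , i2

offDiagonalPosition-injective : Injective _≡_ _≡_ offDiagonalPosition
offDiagonalPosition-injective {i} {j} = toWitness {a? = injective?} _ i j
  where
  injective? = Fin.all? λ i → Fin.all? λ j →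
    ≡-dec Fin._≟_ Fin._≟_ (offDiagonalPosition i) (offDiagonalPosition j) →-dec i Fin.≟ j

module _ {S : Array} (magic : IsMagicFilling S) where

  private
    entries-injective : ∀ {i j k l} → S i j ≡ S k l → (i , j) ≡ (k , l)
    entries-injective e = ×-≡,≡→≡ (proj₂ magic _ _ _ _ e)

    rows-differ : ∀ {i j k l} → i ≢ k → S i j ≢ S k l
    rows-differ i≢k = i≢k ∘ cong proj₁ ∘ entries-injective

  Xset-unique : Unique (Xset S)
  Xset-unique = tabulate⁺ {f = uncurry S ∘ offDiagonalPosition} (offDiagonalPosition-injective ∘ entries-injective)

  Xset-bounded : Bounded (_∈ Xset S)
  Xset-bounded = + 1 , 8 , λ z∈ → entry-bounds (∈-tabulate⁻ {f = uncurry S ∘ offDiagonalPosition} z∈)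
    where
    entry-bounds : ∀ {z} → ∃ (λ i → z ≡ uncurry S (offDiagonalPosition i)) → + 1 ≤ z × z ≤ + 9
    entry-bounds (_ , refl) = proj₁ magic _ _

  plusEntries-unique : Unique (plusEntries S)
  plusEntries-unique = (rows-differ (λ ()) ∷ rows-differ (λ ()) ∷ []) ∷ (rows-differ (λ ()) ∷ []) ∷ [] ∷ []

  module _ {a : ℤ} (a≢0 : a ≢ + 0) where

    triplet⇒halving : ∀ {y1 y2 y3} → IsTriplet S a y1 y2 y3 → Halving a (_∈ Xset S) (_∈ y1 ∷ y2 ∷ y3 ∷ [])
    triplet⇒halving (_ , _ , _ , _ , _ , ys±≐X) =
      withShifts≐⇒halving (covering-unique ℕ.≤-refl (Equivalence.from (ys±≐X _)) Xset-unique) ys±≐X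

    Sa⇒halving : SaExists S a → Halving a (_∈ Xset S) (_∈ plusEntries S)
    Sa⇒halving Sa = Halving-resp (plus∈offDiagonal⇔ S)
      (shifted≐⇒halving Xset-unique a≢0 Xset-bounded Sa
        (covering-unique ℕ.≤-refl (Equivalence.from (Sa _)) Xset-unique))

    halving⇒Sa : Halving a (_∈ Xset S) (_∈ plusEntries S) → SaExists S a
    halving⇒Sa H = halving⇒shifted≐ Xset-unique (Halving-resp (⇔.sym ∘ plus∈offDiagonal⇔ S) H)

    halving⇒triplet : Halving a (_∈ Xset S) (_∈ plusEntries S) → TripletExists S a
    halving⇒triplet H with increasing-listing plusEntries-unique
    ... | y1 , y2 , y3 , y1<y2 , y2<y3 , ys↭A =
      y1 , y2 , y3 , inside (here refl) , inside (there (here refl)) , inside (there (there (here refl))) ,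
      y1<y2 , y2<y3 , halving⇒withShifts≐ H′
      where
      H′ : Halving a (_∈ Xset S) (_∈ y1 ∷ y2 ∷ y3 ∷ [])
      H′ = Halving-resp (λ _ → mk⇔ (∈-resp-↭ (↭-sym ys↭A)) (∈-resp-↭ ys↭A)) H
      open Halving H′

proposition2p6 : (S : Array) → IsMagicFilling S → (a : ℤ) → a ≢ + 0 →
    (¬ TripletExists S a → ¬ SaExists S a) ×
    (∀ y1 y2 y3 → IsTriplet S a y1 y2 y3 →
      SaExists S a ⇔ ((y1 ∷ y2 ∷ y3 ∷ []) ≐ (S i1 i2 ∷ S i2 i3 ∷ S i3 i1 ∷ [])))
proposition2p6 S magic a a≢0 =
  (λ no-triplet → no-triplet ∘ halving⇒triplet magic a≢0 ∘ Sa⇒halving magic a≢0) ,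
  λ y1 y2 y3 triplet → mk⇔
    (λ Sa → halving-unique a≢0 (Xset-bounded magic) (triplet⇒halving magic a≢0 triplet) (Sa⇒halving magic a≢0 Sa))
    (λ T≐A → halving⇒Sa magic a≢0 (Halving-resp T≐A (triplet⇒halving magic a≢0 triplet)))
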